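{- $\limsup_{n\to\infty} \frac{f(n)}{n}\le \frac13$.
   Context: For a positive integer $n$, $T_n$ denotes the triangular lattice with $n$ rows: the set of points $\{a(1,0)+b(\tfrac12,\tfrac{\sqrt3}{2}) : a,b\in\mathbb{Z}_{\ge 0},\ a+b\le n-1\}$ in the plane. A proper coloring of $T_n$ is an assignment of colors to the points of $T_n$ such that no three points of $T_n$ that are the vertices of an equilateral triangle (of any size and any orientation) all receive the same color. $f(n)$ denotes the minimum number of colors in a proper coloring of $T_n$. -}

module Defs where

open import Data.Nat as ℕ using (ℕ; suc)
open import Data.Integer as ℤ using (ℤ; +_; _+_; _-_; _≤_)
open import Data.Fin using (Fin)
open import Data.Product using (_×_)
open import Relation.Binary.PropositionalEquality using (_≡_)
open import Relation.Nullary using (¬_)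

-- Lattice coordinates: (a , b) stands for the point a·(1,0) + b·(1/2, √3/2).
-- T n = { (a , b) : a , b ≥ 0 , a + b ≤ n - 1 }.
InT : ℕ → ℤ → ℤ → Set
InT n a b = (+ 0 ≤ a) × (+ 0 ≤ b) × (a + b + ℤ.1ℤ ≤ + n)

-- Rotation by 60° in lattice coordinates sends (x , y) to (- y , x + y).
-- Every equilateral triangle (any size, any orientation) with vertices in the
-- lattice is, for a suitable ordering of its vertices, of the form
--   P , P + v , P + rot60 v   with v ≠ 0.
-- A coloring is a map from lattice points to Fin c (values off T n are irrelevant).
Proper : (n c : ℕ) → (ℤ → ℤ → Fin c) → Set
Proper n c χ =
  ∀ (a b x y : ℤ) → ¬ ((x ≡ + 0) × (y ≡ + 0)) →
  InT n a b → InT n (a + x) (b + y) → InT n (a - y) (b + x + y) →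
  ¬ ((χ a b ≡ χ (a + x) (b + y)) × (χ a b ≡ χ (a - y) (b + x + y)))

Colorable : ℕ → ℕ → Set
Colorable n c = Data.Product.Σ (ℤ → ℤ → Fin c) (Proper n c)

-- IsF n m  :⇔  m = f(n), the minimum number of colors of a proper coloring of T n.
IsF : ℕ → ℕ → Set
IsF n m = Colorable n m × (∀ c → Colorable n c → m ℕ.≤ c)

-- Colour ℤ² by a 3-colouring of its residues modulo 4 in which no triangle
-- P, P + v, P + ρv (ρ the rotation by 60°) is monochromatic unless v ≡ 0 (mod 4).
-- Nesting this colouring J times along the base-4 digits of the coordinates uses
-- 3^J colours, and then every monochromatic triangle has v ≡ 0 (mod 4^J); inside
-- T_n with n ≤ 4^J this forces v = 0. Hence f(n) ≤ 3^⌈log₄ n⌉, which is o(n).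
module Submission where

open import Defs
open import Data.Nat using (ℕ; suc; _*_; _+_; _≤_)
open import Data.Product using (∃-syntax)

open import Data.Nat as ℕ using (zero; _^_; _<_; s≤s; z≤n; NonZero)
import Data.Nat.Properties as ℕ
import Data.Nat.Divisibility as ℕ
import Data.Nat.Tactic.RingSolver as ℕ-Solver
open import Data.Integer as ℤ using (ℤ; +_; _-_; ∣_∣; _%ℕ_; _/ℕ_; 0ℤ)
import Data.Integer.Properties as ℤ
open import Data.Integer.DivMod using (n%ℕd<d; a≡a%ℕn+[a/ℕn]*n)
open import Data.Integer.Divisibility.Signed
  using (_∣_; _∣?_; divides; ∣⇒∣ᵤ; ∣m∣n⇒∣m+n; ∣m∣n⇒∣m-n; ∣m⇒∣-m; *-monoˡ-∣)
open import Data.Integer.Tactic.RingSolver using (solve-∀)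
open import Data.Fin using (Fin; zero; toℕ; fromℕ<; combine; #_)
open import Data.Fin.Properties using (toℕ-fromℕ<; fromℕ<-cong; combine-injective; all?)
  renaming (_≟_ to _≟ᶠ_)
open import Data.Vec using (Vec; []; _∷_; lookup)
open import Data.Product using (_×_; _,_; proj₁; proj₂)
open import Data.Sum using (inj₁; inj₂)
open import Relation.Nullary using (Dec; contradiction)
open import Relation.Nullary.Decidable using (_×-dec_; _→-dec_; from-yes)
open import Relation.Binary.PropositionalEquality

Coloring : ℕ → Set
Coloring c = ℤ → ℤ → Fin c

Monochromatic : ∀ {c} → Coloring c → ℤ → ℤ → ℤ → ℤ → Set
Monochromatic χ a b x y = (χ a b ≡ χ (a ℤ.+ x) (b ℤ.+ y)) × (χ a b ≡ χ (a - y) (b ℤ.+ x ℤ.+ y))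

monochromatic? : ∀ {c} (χ : Coloring c) a b x y → Dec (Monochromatic χ a b x y)
monochromatic? χ a b x y =
  (χ a b ≟ᶠ χ (a ℤ.+ x) (b ℤ.+ y)) ×-dec (χ a b ≟ᶠ χ (a - y) (b ℤ.+ x ℤ.+ y))

Rigid : ∀ {c} → ℕ → Coloring c → Set
Rigid q χ = ∀ a b x y → Monochromatic χ a b x y → (+ q ∣ x) × (+ q ∣ y)

[i+j]-i≡j : ∀ i j → i ℤ.+ j - i ≡ j
[i+j]-i≡j = solve-∀

infix 4 _≡_mod_
record _≡_mod_ (i j : ℤ) (q : ℕ) : Set where
  constructor ≡-mod
  field
    divides-difference : + q ∣ i - j

≡-mod-sym : ∀ {q i j} → i ≡ j mod q → j ≡ i mod q
≡-mod-sym {q} {i} {j} (≡-mod q∣i-j) = ≡-mod (subst (+ q ∣_) (negate i j) (∣m⇒∣-m q∣i-j))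
  where
  negate : ∀ i j → ℤ.- (i - j) ≡ j - i
  negate = solve-∀

≡-mod-trans : ∀ {q i j k} → i ≡ j mod q → j ≡ k mod q → i ≡ k mod q
≡-mod-trans {q} {i} {j} {k} (≡-mod q∣i-j) (≡-mod q∣j-k) =
  ≡-mod (subst (+ q ∣_) (ℤ.+-minus-telescope i j k) (∣m∣n⇒∣m+n q∣i-j q∣j-k))

+-cong-mod : ∀ {q i j k l} → i ≡ j mod q → k ≡ l mod q → i ℤ.+ k ≡ j ℤ.+ l mod q
+-cong-mod {q} {i} {j} {k} {l} (≡-mod q∣i-j) (≡-mod q∣k-l) =
  ≡-mod (subst (+ q ∣_) (regroup i j k l) (∣m∣n⇒∣m+n q∣i-j q∣k-l))
  where
  regroup : ∀ i j k l → (i - j) ℤ.+ (k - l) ≡ (i ℤ.+ k) - (j ℤ.+ l)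
  regroup = solve-∀

minus-cong-mod : ∀ {q i j k l} → i ≡ j mod q → k ≡ l mod q → i - k ≡ j - l mod q
minus-cong-mod {q} {i} {j} {k} {l} (≡-mod q∣i-j) (≡-mod q∣k-l) =
  ≡-mod (subst (+ q ∣_) (regroup i j k l) (∣m∣n⇒∣m-n q∣i-j q∣k-l))
  where
  regroup : ∀ i j k l → (i - j) - (k - l) ≡ (i - k) - (j - l)
  regroup = solve-∀

≡-mod⇒∣ : ∀ {q i j} → i ≡ j mod q → + q ∣ j → + q ∣ i
≡-mod⇒∣ {q} {i} {j} (≡-mod q∣i-j) q∣j = subst (+ q ∣_) (regroup i j) (∣m∣n⇒∣m+n q∣i-j q∣j)
  where
  regroup : ∀ i j → (i - j) ℤ.+ j ≡ i
  regroup = solve-∀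

∣∧<⇒≡0 : ∀ {d m} → d ℕ.∣ m → m < d → m ≡ 0
∣∧<⇒≡0 {m = zero}  _   _   = refl
∣∧<⇒≡0 {m = suc _} d∣m m<d = contradiction d∣m (ℕ.>⇒∤ m<d)

≡-mod-<⇒≡ : ∀ {d m n} → + m ≡ + n mod d → m < d → n < d → m ≡ n
≡-mod-<⇒≡ {d} {m} {n} (≡-mod d∣m-n) m<d n<d =
  ℤ.+-injective (ℤ.i-j≡0⇒i≡j (+ m) (+ n) (ℤ.∣i∣≡0⇒i≡0 (∣∧<⇒≡0 (∣⇒∣ᵤ d∣m-n) ∣m-n∣<d)))
  where
  ∣m-n∣<d : ∣ + m - + n ∣ < d
  ∣m-n∣<d = subst (_< d) (cong ∣_∣ (sym (ℤ.m-n≡m⊖n m n)))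
              (ℕ.≤-<-trans (ℤ.∣m⊝n∣≤m⊔n m n) (ℕ.⊔-lub m<d n<d))

module _ (q : ℕ) .{{_ : NonZero q}} where

  [i/ℕq]*q≡i-i%ℕq : ∀ i → i /ℕ q ℤ.* + q ≡ i - + (i %ℕ q)
  [i/ℕq]*q≡i-i%ℕq i = begin
    i /ℕ q ℤ.* + q                               ≡⟨ [i+j]-i≡j (+ (i %ℕ q)) (i /ℕ q ℤ.* + q) ⟨
    + (i %ℕ q) ℤ.+ i /ℕ q ℤ.* + q - + (i %ℕ q)    ≡⟨ cong (_- + (i %ℕ q)) (a≡a%ℕn+[a/ℕn]*n i q) ⟨
    i - + (i %ℕ q)                               ∎
    where open ≡-Reasoning

  ≡-mod-%ℕ : ∀ i → i ≡ + (i %ℕ q) mod q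
  ≡-mod-%ℕ i = ≡-mod (divides (i /ℕ q) (sym ([i/ℕq]*q≡i-i%ℕq i)))

  ≡-mod⇒%ℕ≡ : ∀ {i j} → i ≡ j mod q → i %ℕ q ≡ j %ℕ q
  ≡-mod⇒%ℕ≡ {i} {j} i≡j = ≡-mod-<⇒≡
    (≡-mod-trans (≡-mod-sym (≡-mod-%ℕ i)) (≡-mod-trans i≡j (≡-mod-%ℕ j)))
    (n%ℕd<d i q) (n%ℕd<d j q)

  [i+k*q]/ℕq≡i/ℕq+k : ∀ i k → (i ℤ.+ k ℤ.* + q) /ℕ q ≡ i /ℕ q ℤ.+ k
  [i+k*q]/ℕq≡i/ℕq+k i k = ℤ.*-cancelʳ-≡ _ _ (+ q) (begin
    j /ℕ q ℤ.* + q                   ≡⟨ [i/ℕq]*q≡i-i%ℕq j ⟩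
    j - + (j %ℕ q)                   ≡⟨ cong (λ r → j - + r) (≡-mod⇒%ℕ≡ j≡i) ⟩
    j - + (i %ℕ q)                   ≡⟨ regroup i (k ℤ.* + q) (+ (i %ℕ q)) ⟩
    i - + (i %ℕ q) ℤ.+ k ℤ.* + q     ≡⟨ cong (ℤ._+ k ℤ.* + q) ([i/ℕq]*q≡i-i%ℕq i) ⟨
    i /ℕ q ℤ.* + q ℤ.+ k ℤ.* + q     ≡⟨ ℤ.*-distribʳ-+ (+ q) (i /ℕ q) k ⟨
    (i /ℕ q ℤ.+ k) ℤ.* + q           ∎)
    where
    open ≡-Reasoning
    j = i ℤ.+ k ℤ.* + q
    regroup : ∀ i s r → i ℤ.+ s - r ≡ i - r ℤ.+ s
    regroup = solve-∀
    j≡i : j ≡ i mod q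
    j≡i = ≡-mod (divides k ([i+j]-i≡j i (k ℤ.* + q)))

  digit : ℤ → Fin q
  digit i = fromℕ< (n%ℕd<d i q)

  digit-cong : ∀ {i j} → i ≡ j mod q → digit i ≡ digit j
  digit-cong i≡j = fromℕ<-cong _ _ (≡-mod⇒%ℕ≡ i≡j) _ _

  ≡-mod-digit : ∀ i → i ≡ + toℕ (digit i) mod q
  ≡-mod-digit i = subst (λ r → i ≡ + r mod q) (sym (toℕ-fromℕ< (n%ℕd<d i q))) (≡-mod-%ℕ i)

  periodic : ∀ {c} → (Fin q → Fin q → Fin c) → Coloring c
  periodic τ a b = τ (digit a) (digit b)

  periodic-rigid : ∀ {c} (τ : Fin q → Fin q → Fin c) →
    (∀ i j k l → Monochromatic (periodic τ) (+ toℕ i) (+ toℕ j) (+ toℕ k) (+ toℕ l) →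
       (+ q ∣ + toℕ k) × (+ q ∣ + toℕ l)) →
    Rigid q (periodic τ)
  periodic-rigid τ rigid-on-residues a b x y (e₁ , e₂) =
    ≡-mod⇒∣ (≡-rep x) (proj₁ q∣digits) , ≡-mod⇒∣ (≡-rep y) (proj₂ q∣digits)
    where
    rep : ℤ → ℤ
    rep i = + toℕ (digit i)
    ≡-rep : ∀ i → i ≡ rep i mod q
    ≡-rep = ≡-mod-digit
    periodic-cong : ∀ {u u′ v v′} → u ≡ u′ mod q → v ≡ v′ mod q → periodic τ u v ≡ periodic τ u′ v′
    periodic-cong u≡u′ v≡v′ = cong₂ τ (digit-cong u≡u′) (digit-cong v≡v′)
    origin : periodic τ a b ≡ periodic τ (rep a) (rep b)
    origin = periodic-cong (≡-rep a) (≡-rep b)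
    first : periodic τ (a ℤ.+ x) (b ℤ.+ y) ≡ periodic τ (rep a ℤ.+ rep x) (rep b ℤ.+ rep y)
    first = periodic-cong (+-cong-mod (≡-rep a) (≡-rep x)) (+-cong-mod (≡-rep b) (≡-rep y))
    second : periodic τ (a - y) (b ℤ.+ x ℤ.+ y) ≡
             periodic τ (rep a - rep y) (rep b ℤ.+ rep x ℤ.+ rep y)
    second = periodic-cong (minus-cong-mod (≡-rep a) (≡-rep y))
                           (+-cong-mod (+-cong-mod (≡-rep b) (≡-rep x)) (≡-rep y))
    q∣digits : (+ q ∣ rep x) × (+ q ∣ rep y)
    q∣digits = rigid-on-residues (digit a) (digit b) (digit x) (digit y)
      (trans (sym origin) (trans e₁ first) , trans (sym origin) (trans e₂ second))

_⊗⟨_⟩_ : ∀ {c d} → Coloring c → (q : ℕ) .{{_ : NonZero q}} → Coloring d → Coloring (c * d)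
(κ ⊗⟨ q ⟩ χ) a b = combine (κ a b) (χ (a /ℕ q) (b /ℕ q))

-- κ forces q ∣ v; dividing by q then turns the triangle into a monochromatic one of χ.
⊗-rigid : ∀ {c d q Q} .{{_ : NonZero q}} {κ : Coloring c} {χ : Coloring d} →
          Rigid q κ → Rigid Q χ → Rigid (q * Q) (κ ⊗⟨ q ⟩ χ)
⊗-rigid {q = q} {Q} {κ} {χ} κ-rigid χ-rigid a b _ _ (e₁ , e₂)
  with combine-injective _ _ _ _ e₁ | combine-injective _ _ _ _ e₂
... | κ₁ , χ₁ | κ₂ , χ₂ with κ-rigid a b _ _ (κ₁ , κ₂)
... | divides x refl , divides y refl = scale (proj₁ Q∣x,y) , scale (proj₂ Q∣x,y)
  where
  shift : ∀ i k → (i ℤ.+ k ℤ.* + q) /ℕ q ≡ i /ℕ q ℤ.+ k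
  shift = [i+k*q]/ℕq≡i/ℕq+k q
  Q∣x,y : (+ Q ∣ x) × (+ Q ∣ y)
  Q∣x,y = χ-rigid (a /ℕ q) (b /ℕ q) x y
    ( trans χ₁ (cong₂ χ (shift a x) (shift b y))
    , trans χ₂ (cong₂ χ
        (trans (cong (λ t → (a ℤ.+ t) /ℕ q) (ℤ.neg-distribˡ-* y (+ q))) (shift a (ℤ.- y)))
        (trans (shift (b ℤ.+ x ℤ.* + q) y) (cong (ℤ._+ y) (shift b x)))))
  scale : ∀ {s} → + Q ∣ s → + (q * Q) ∣ s ℤ.* + q
  scale {s} Q∣s = subst (_∣ s ℤ.* + q) (trans (sym (ℤ.pos-* Q q)) (cong +_ (ℕ.*-comm Q q)))
                    (*-monoˡ-∣ (+ q) Q∣s)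

⊗-power : ∀ {c} (q : ℕ) .{{_ : NonZero q}} → Coloring c → (J : ℕ) → Coloring (c ^ J)
⊗-power q κ zero    = λ _ _ → zero
⊗-power q κ (suc J) = κ ⊗⟨ q ⟩ ⊗-power q κ J

⊗-power-rigid : ∀ {c q} .{{_ : NonZero q}} {κ : Coloring c} →
                Rigid q κ → ∀ J → Rigid (q ^ J) (⊗-power q κ J)
⊗-power-rigid κ-rigid zero _ _ x y _ = 1∣ x , 1∣ y
  where
  1∣ : ∀ i → + 1 ∣ i
  1∣ i = divides i (sym (ℤ.*-identityʳ i))
⊗-power-rigid κ-rigid (suc J) = ⊗-rigid κ-rigid (⊗-power-rigid κ-rigid J)

tile : Fin 4 → Fin 4 → Fin 3
tile i j = lookup (lookup rows i) j
  where
  rows : Vec (Vec (Fin 3) 4) 4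
  rows = (# 0 ∷ # 0 ∷ # 0 ∷ # 1 ∷ [])
       ∷ (# 1 ∷ # 2 ∷ # 0 ∷ # 1 ∷ [])
       ∷ (# 2 ∷ # 0 ∷ # 2 ∷ # 2 ∷ [])
       ∷ (# 0 ∷ # 2 ∷ # 1 ∷ # 1 ∷ [])
       ∷ []

tile-rigid : Rigid 4 (periodic 4 tile)
tile-rigid = periodic-rigid 4 tile (from-yes
  (all? λ (i : Fin 4) → all? λ (j : Fin 4) → all? λ (k : Fin 4) → all? λ (l : Fin 4) →
     monochromatic? (periodic 4 tile) (+ toℕ i) (+ toℕ j) (+ toℕ k) (+ toℕ l)
       →-dec (+ 4 ∣? + toℕ k) ×-dec (+ 4 ∣? + toℕ l)))

InT⇒∣∣< : ∀ {n a b} → InT n a b → ∣ a ∣ < n × ∣ b ∣ < n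
InT⇒∣∣< {n} {+ a} {+ b} (ℤ.+≤+ _ , ℤ.+≤+ _ , a+b+1≤n) =
  ℕ.≤-trans (s≤s (ℕ.m≤m+n a b)) 1+a+b≤n , ℕ.≤-trans (s≤s (ℕ.m≤n+m b a)) 1+a+b≤n
  where
  1+a+b≤n : suc (a ℕ.+ b) ≤ n
  1+a+b≤n = subst (_≤ n) (ℕ.+-comm (a ℕ.+ b) 1) (ℤ.drop‿+≤+ a+b+1≤n)

multiple-in-window≡0 : ∀ {q i x} → + q ∣ x → 0ℤ ℤ.≤ i → 0ℤ ℤ.≤ i ℤ.+ x →
                       ∣ i ∣ < q → ∣ i ℤ.+ x ∣ < q → x ≡ 0ℤ
multiple-in-window≡0 {q} {i} {x} q∣x 0≤i 0≤i+x i<q i+x<q = begin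
  x                         ≡⟨ difference ⟨
  + ∣ i ℤ.+ x ∣ - + ∣ i ∣    ≡⟨ cong (λ m → + m - + ∣ i ∣) endpoints-equal ⟩
  + ∣ i ∣ - + ∣ i ∣          ≡⟨ ℤ.+-inverseʳ (+ ∣ i ∣) ⟩
  0ℤ                        ∎
  where
  open ≡-Reasoning
  difference : + ∣ i ℤ.+ x ∣ - + ∣ i ∣ ≡ x
  difference = trans (cong₂ _-_ (ℤ.0≤i⇒+∣i∣≡i 0≤i+x) (ℤ.0≤i⇒+∣i∣≡i 0≤i)) ([i+j]-i≡j i x)
  endpoints-equal : ∣ i ℤ.+ x ∣ ≡ ∣ i ∣
  endpoints-equal = ≡-mod-<⇒≡ (≡-mod (subst (+ q ∣_) (sym difference) q∣x)) i+x<q i<q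

rigid⇒proper : ∀ {n q c} {χ : Coloring c} → n ≤ q → Rigid q χ → Proper n c χ
rigid⇒proper {n} {q} n≤q rigid a b x y nondegenerate
  P@(0≤a , 0≤b , _) P+v@(0≤a+x , 0≤b+y , _) _ mono
  with rigid a b x y mono
... | q∣x , q∣y = nondegenerate
  ( multiple-in-window≡0 q∣x 0≤a 0≤a+x (within (proj₁ (InT⇒∣∣< P))) (within (proj₁ (InT⇒∣∣< P+v)))
  , multiple-in-window≡0 q∣y 0≤b 0≤b+y (within (proj₂ (InT⇒∣∣< P))) (within (proj₂ (InT⇒∣∣< P+v))))
  where
  within : ∀ {m} → m < n → m < q
  within m<n = ℕ.<-≤-trans m<n n≤q

colorable : ∀ {n} J → n ≤ 4 ^ J → Colorable n (3 ^ J)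
colorable J n≤4ᴶ = ⊗-power 4 (periodic 4 tile) J , rigid⇒proper n≤4ᴶ (⊗-power-rigid tile-rigid J)

IsF⇒≤3^ : ∀ {n m} J → n ≤ 4 ^ J → IsF n m → m ≤ 3 ^ J
IsF⇒≤3^ J n≤4ᴶ (_ , minimal) = minimal (3 ^ J) (colorable J n≤4ᴶ)

[b+n]*b^n≤b*[1+b]^n : ∀ b n → (b + n) * b ^ n ≤ b * suc b ^ n
[b+n]*b^n≤b*[1+b]^n b zero    = ℕ.≤-reflexive (cong (_* 1) (ℕ.+-identityʳ b))
[b+n]*b^n≤b*[1+b]^n b (suc n) = begin
  (b + suc n) * (b * b ^ n)               ≤⟨ ℕ.m≤m+n _ (n * b ^ n) ⟩
  (b + suc n) * (b * b ^ n) + n * b ^ n   ≡⟨ regroup b n (b ^ n) ⟩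
  suc b * ((b + n) * b ^ n)               ≤⟨ ℕ.*-monoʳ-≤ (suc b) ([b+n]*b^n≤b*[1+b]^n b n) ⟩
  suc b * (b * suc b ^ n)                 ≡⟨ ℕ.*-comm (suc b) _ ⟩
  b * suc b ^ n * suc b                   ≡⟨ ℕ.*-assoc b _ (suc b) ⟩
  b * (suc b ^ n * suc b)                 ≡⟨ cong (b *_) (ℕ.*-comm (suc b ^ n) (suc b)) ⟩
  b * suc b ^ suc n                       ∎
  where
  open ℕ.≤-Reasoning
  regroup : ∀ b n X → (b + suc n) * (b * X) + n * X ≡ suc b * ((b + n) * X)
  regroup = ℕ-Solver.solve-∀

power-bracket : ∀ {b} B n → 1 < b → b ^ B < n → ∃[ J ] B ≤ J × b ^ J < n × n ≤ b ^ suc J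
power-bracket {b} B (suc n) 1<b (s≤s bᴮ≤n) with ℕ.m≤n⇒m<n∨m≡n bᴮ≤n
... | inj₂ refl = B , ℕ.≤-refl , ℕ.≤-refl , ℕ.^-monoʳ-< b 1<b (ℕ.n<1+n B)
... | inj₁ bᴮ<n with power-bracket B n 1<b bᴮ<n
...   | J , B≤J , bᴶ<n , n≤bᴶ⁺¹ with ℕ.m≤n⇒m<n∨m≡n n≤bᴶ⁺¹
...     | inj₁ n<bᴶ⁺¹ = J , B≤J , ℕ.m<n⇒m<1+n bᴶ<n , n<bᴶ⁺¹
...     | inj₂ refl   = suc J , ℕ.m≤n⇒m≤1+n B≤J , ℕ.≤-refl , ℕ.^-monoʳ-< b 1<b (ℕ.n<1+n (suc J))

f-sublinear : ∀ K → ∃[ N ] ∀ n m → N ≤ n → IsF n m → K * m ≤ n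
f-sublinear K = suc (4 ^ (9 * K)) , bound
  where
  bound : ∀ n m → suc (4 ^ (9 * K)) ≤ n → IsF n m → K * m ≤ n
  bound n m 4⁹ᴷ<n isF with power-bracket (9 * K) n (s≤s (s≤s z≤n)) 4⁹ᴷ<n
  ... | J , 9K≤J , 4ᴶ<n , n≤4ᴶ⁺¹ = begin
    K * m               ≤⟨ ℕ.*-monoʳ-≤ K (IsF⇒≤3^ (suc J) n≤4ᴶ⁺¹ isF) ⟩
    K * (3 * 3 ^ J)     ≤⟨ ℕ.*-cancelˡ-≤ {K * (3 * 3 ^ J)} {4 ^ J} 3 (begin
      3 * (K * (3 * 3 ^ J))  ≡⟨ regroup K (3 ^ J) ⟩
      9 * K * 3 ^ J          ≤⟨ ℕ.*-monoˡ-≤ (3 ^ J) (ℕ.≤-trans 9K≤J (ℕ.m≤n+m J 3)) ⟩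
      (3 + J) * 3 ^ J        ≤⟨ [b+n]*b^n≤b*[1+b]^n 3 J ⟩
      3 * 4 ^ J              ∎) ⟩
    4 ^ J               ≤⟨ ℕ.<⇒≤ 4ᴶ<n ⟩
    n                   ∎
    where
    open ℕ.≤-Reasoning
    regroup : ∀ K X → 3 * (K * (3 * X)) ≡ 9 * K * X
    regroup = ℕ-Solver.solve-∀

mainTheorem3 : ∀ (k : ℕ) → ∃[ N ] ∀ (n m : ℕ) → N ≤ n → IsF n m →
                 3 * suc k * m ≤ (suc k + 3) * n
mainTheorem3 k =
  let N , sublinear = f-sublinear (3 * suc k) in
  N , λ n m N≤n isF → ℕ.≤-trans (sublinear n m N≤n isF) (ℕ.m≤n*m n (suc k + 3))
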